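{- Let $n\in\mathbb{N}$ and let $a_1,\ldots,a_n,b_1,\ldots,b_n$ be positive integers. Let $(S_A,S_B)$ be a partition of $S=\{1,\ldots,n\}$ (i.e. $S_A\cap S_B=\emptyset$, $S_A\cup S_B=S$, parts possibly empty) such that \[\sum_{i\in S_A}a_i\ge\sum_{i\in S_A}b_i\quad\text{and}\quad\sum_{i\in S_B}b_i\ge\sum_{i\in S_B}a_i .\] Then $\sum_{i\in S_A}a_i\ge\sum_{i\in S_B}a_i$ or $\sum_{i\in S_B}b_i\ge\sum_{i\in S_A}b_i$ (i.e. at least one of the two players is free of envy).
   Context: Two players $A$ and $B$ share $n$ indivisible goods; good $i$ has value $a_i$ for $A$ and $b_i$ for $B$. An allocation is a partition $(S_A,S_B)$ of $\{1,\ldots,n\}$, $A$ receiving $S_A$ and $B$ receiving $S_B$. An allocation satisfying the two displayed inequalities of the hypothesis is called an LPV (Larger-than-swap-Player-Valuation) allocation. Player $A$ is free of envy if $\sum_{S_A}a_i\ge\sum_{S_B}a_i$, and player $B$ is free of envy if $\sum_{S_B}b_i\ge\sum_{S_A}b_i$. -}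

module Defs where

open import Data.Nat using (ℕ; zero; suc; _+_; _≥_)
open import Data.Product using (_×_)
open import Data.Fin using (Fin; zero; suc)
open import Data.Bool using (Bool; true; false; if_then_else_)

Σ-Fin : (n : ℕ) → (Fin n → ℕ) → ℕ
Σ-Fin zero    f = 0
Σ-Fin (suc n) f = f zero + Σ-Fin n (λ i → f (suc i))

-- An allocation (partition (S_A, S_B) of the goods Fin n) is represented by its
-- indicator of S_A: toA i = true iff i ∈ S_A, and S_B is the complement.
Allocation : ℕ → Set
Allocation n = Fin n → Bool

sumA : {n : ℕ} → Allocation n → (Fin n → ℕ) → ℕ
sumA {n} toA v = Σ-Fin n (λ i → if toA i then v i else 0)

sumB : {n : ℕ} → Allocation n → (Fin n → ℕ) → ℕ
sumB {n} toA v = Σ-Fin n (λ i → if toA i then 0 else v i)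

LPV : {n : ℕ} → (a b : Fin n → ℕ) → Allocation n → Set
LPV a b toA = (sumA toA a ≥ sumA toA b) × (sumB toA b ≥ sumB toA a)

EnvyFreeA : {n : ℕ} → (a : Fin n → ℕ) → Allocation n → Set
EnvyFreeA a toA = sumA toA a ≥ sumB toA a

EnvyFreeB : {n : ℕ} → (b : Fin n → ℕ) → Allocation n → Set
EnvyFreeB b toA = sumB toA b ≥ sumA toA b

module Submission where

open import Defs
open import Data.Nat using (ℕ; _≤_; _>_)
open import Data.Fin using (Fin)
open import Data.Sum using (_⊎_; inj₁; inj₂)
open import Data.Product using (_,_)
open import Data.Nat.Properties using (_≤?_; ≰⇒>; ≤-trans; <⇒≤)
open import Relation.Nullary using (yes; no)

-- If A envies then sumA b ≤ sumA a < sumB a ≤ sumB b, so B does not.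
≤-or-≤-via-chain : ∀ {w x y z : ℕ} → w ≤ x → y ≤ z → y ≤ x ⊎ w ≤ z
≤-or-≤-via-chain {x = x} {y} w≤x y≤z with y ≤? x
... | yes y≤x = inj₁ y≤x
... | no  y≰x = inj₂ (≤-trans w≤x (≤-trans (<⇒≤ (≰⇒> y≰x)) y≤z))

lemma3 : (n : ℕ) (a b : Fin n → ℕ) →
         (∀ i → a i > 0) → (∀ i → b i > 0) →
         (toA : Allocation n) → LPV a b toA →
         EnvyFreeA a toA ⊎ EnvyFreeB b toA
lemma3 n a b _ _ toA (lpvA , lpvB) = ≤-or-≤-via-chain lpvA lpvB
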